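{- For all integers $m$ and $n$, \[ F_m \sum_{k = 1}^n (-1)^{mk - 1} L_{2mk} = (-1)^{mn - 1} F_{mn} L_{mn + m}. \]
   Context: $F_n$ and $L_n$ ($n\in\mathbb{Z}$) are the Fibonacci and Lucas numbers: $F_n=F_{n-1}+F_{n-2}$ with $F_0=0$, $F_1=1$; $L_n=L_{n-1}+L_{n-2}$ with $L_0=2$, $L_1=1$; extended to negative indices by $F_{ -n}=(-1)^{n-1}F_n$, $L_{ -n}=(-1)^nL_n$. For $n=0$ the sum $\sum_{k=1}^n$ is empty. For $n<0$ the sum follows the convention $\sum_{k=1}^n a_k=-\sum_{k=n+1}^{0}a_k$. -}

module Defs where

open import Data.Nat using (ℕ; zero; suc)
open import Data.Integer using (ℤ; +_; -[1+_]; _+_; _-_; _*_; -_)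

fibℕ : ℕ → ℤ
fibℕ zero = + 0
fibℕ (suc zero) = + 1
fibℕ (suc (suc n)) = fibℕ (suc n) + fibℕ n

lucℕ : ℕ → ℤ
lucℕ zero = + 2
lucℕ (suc zero) = + 1
lucℕ (suc (suc n)) = lucℕ (suc n) + lucℕ n

negOnePowℕ : ℕ → ℤ
negOnePowℕ zero = + 1
negOnePowℕ (suc n) = - negOnePowℕ n

-- (-1)^k for k : ℤ  (note (-1)^(-j) = (-1)^j)
negOnePow : ℤ → ℤ
negOnePow (+ n) = negOnePowℕ n
negOnePow -[1+ n ] = negOnePowℕ (suc n)

-- F_n for n : ℤ, with F_{-n} = (-1)^{n-1} F_n
F : ℤ → ℤ
F (+ n) = fibℕ n
F -[1+ n ] = negOnePowℕ n * fibℕ (suc n)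

-- L_n for n : ℤ, with L_{-n} = (-1)^n L_n
L : ℤ → ℤ
L (+ n) = lucℕ n
L -[1+ n ] = negOnePowℕ (suc n) * lucℕ (suc n)

sumℕ : (ℤ → ℤ) → ℕ → ℤ
sumℕ a zero = + 0
sumℕ a (suc n) = sumℕ a n + a (+ suc n)

-- Σ_{k=n+1}^{0} a k for n = -(j+1): terms k = -j, ..., 0
sumNeg : (ℤ → ℤ) → ℕ → ℤ
sumNeg a zero = a (+ 0)
sumNeg a (suc j) = sumNeg a j + a (- (+ suc j))

-- Σ_{k=1}^{n} a k for n : ℤ, with Σ_{k=1}^{n} a k = - Σ_{k=n+1}^{0} a k when n < 0
sumTo : (ℤ → ℤ) → ℤ → ℤ
sumTo a (+ n) = sumℕ a n
sumTo a -[1+ j ] = - sumNeg a j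

{-# OPTIONS --safe #-}
-- Let T(n) be the right-hand side and x = m(n+1).  Multiplying the identity
--   F x L(x+m) = (-1)^m F(x-m) L x + F m L(2x)
-- by (-1)^(x-1) shows that T(n+1) - T(n) is F m times the (n+1)-st summand; as T(0) = 0,
-- both sides agree on all of ℤ.  The identity combines three instances of
--   F(a+b) = F a L b + (-1)^a F(b-a),
-- which holds because, for fixed b, both sides satisfy the Fibonacci recurrence in a (the
-- alternating term through the reflection n ↦ (-1)^n f(c-n)) and agree at a = 0 and a = 1.
module Submission where

open import Data.Nat using (zero; suc)
import Data.Nat.Properties as ℕ
open import Data.Integer using (ℤ; +_; -[1+_]; _+_; _-_; _*_; -_)
open import Data.Integer.Properties
  using ( +-comm; +-assoc; *-assoc; +-identityʳ; *-identityʳ; *-zeroʳ; *-distribˡ-+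
        ; neg-involutive; neg-injective; +-0-abelianGroup)
open import Algebra.Properties.AbelianGroup +-0-abelianGroup
  using () renaming (∙-cancelˡ to +-cancelˡ; ∙-cancelʳ to +-cancelʳ)
open import Data.Integer.Tactic.RingSolver using (solve-∀)
open import Data.Product using (_×_; _,_; proj₁)
open import Relation.Binary.PropositionalEquality
  using (_≡_; refl; sym; trans; cong; cong₂; subst; module ≡-Reasoning)

open import Defs

open ≡-Reasoning

ℤ-induction : (P : ℤ → Set) → P (+ 0) →
              (∀ n → P n → P (n + + 1)) → (∀ n → P (n + + 1) → P n) → ∀ n → P n
ℤ-induction P p₀ up down (+ zero)     = p₀
ℤ-induction P p₀ up down (+ suc k)    =
  subst P (+-comm (+ k) (+ 1)) (up (+ k) (ℤ-induction P p₀ up down (+ k)))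
ℤ-induction P p₀ up down -[1+ zero ]  = down -[1+ 0 ] p₀
ℤ-induction P p₀ up down -[1+ suc j ] =
  down -[1+ suc j ] (ℤ-induction P p₀ up down -[1+ j ])

negOnePow-suc : ∀ a → negOnePow (a + + 1) ≡ - negOnePow a
negOnePow-suc (+ n)        = cong negOnePowℕ (ℕ.+-comm n 1)
negOnePow-suc -[1+ zero ]  = refl
negOnePow-suc -[1+ suc j ] = sym (neg-involutive _)

negOnePow-+ : ∀ a b → negOnePow (a + b) ≡ negOnePow a * negOnePow b
negOnePow-+ a = ℤ-induction (λ b → s (a + b) ≡ s a * s b) base up down
  where
  s = negOnePow

  shift : ∀ b → a + (b + + 1) ≡ (a + b) + + 1
  shift b = sym (+-assoc a b (+ 1))

  neg-*ʳ : ∀ x y → - (x * y) ≡ x * (- y)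
  neg-*ʳ = solve-∀

  base : s (a + + 0) ≡ s a * s (+ 0)
  base = trans (cong s (+-identityʳ a)) (sym (*-identityʳ (s a)))

  up : ∀ b → s (a + b) ≡ s a * s b → s (a + (b + + 1)) ≡ s a * s (b + + 1)
  up b ih = begin
    s (a + (b + + 1))  ≡⟨ cong s (shift b) ⟩
    s (a + b + + 1)    ≡⟨ negOnePow-suc (a + b) ⟩
    - s (a + b)        ≡⟨ cong -_ ih ⟩
    - (s a * s b)      ≡⟨ neg-*ʳ (s a) (s b) ⟩
    s a * (- s b)      ≡⟨ cong (s a *_) (negOnePow-suc b) ⟨
    s a * s (b + + 1)  ∎

  down : ∀ b → s (a + (b + + 1)) ≡ s a * s (b + + 1) → s (a + b) ≡ s a * s b
  down b ih = neg-injective (begin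
    - s (a + b)          ≡⟨ negOnePow-suc (a + b) ⟨
    s (a + b + + 1)      ≡⟨ cong s (shift b) ⟨
    s (a + (b + + 1))    ≡⟨ ih ⟩
    s a * s (b + + 1)    ≡⟨ cong (s a *_) (negOnePow-suc b) ⟩
    s a * (- s b)        ≡⟨ neg-*ʳ (s a) (s b) ⟨
    - (s a * s b)        ∎)

negOnePowℕ-square : ∀ n → negOnePowℕ n * negOnePowℕ n ≡ + 1
negOnePowℕ-square zero    = refl
negOnePowℕ-square (suc n) = trans (neg*neg (negOnePowℕ n)) (negOnePowℕ-square n)
  where
  neg*neg : ∀ t → (- t) * (- t) ≡ t * t
  neg*neg = solve-∀

negOnePow-square : ∀ a → negOnePow a * negOnePow a ≡ + 1
negOnePow-square (+ n)    = negOnePowℕ-square n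
negOnePow-square -[1+ n ] = negOnePowℕ-square (suc n)

negOnePow-- : ∀ a b → negOnePow (a - b) ≡ negOnePow a * negOnePow b
negOnePow-- a b = begin
  s (a - b)                  ≡⟨ *-identityʳ (s (a - b)) ⟨
  s (a - b) * + 1            ≡⟨ cong (s (a - b) *_) (negOnePow-square b) ⟨
  s (a - b) * (s b * s b)    ≡⟨ reassoc (s (a - b)) (s b) ⟩
  s (a - b) * s b * s b      ≡⟨ cong (_* s b) (negOnePow-+ (a - b) b) ⟨
  s (a - b + b) * s b        ≡⟨ cong (λ i → s i * s b) (cancel a b) ⟩
  s a * s b                  ∎
  where
  s = negOnePow
  reassoc : ∀ x y → x * (y * y) ≡ x * y * y
  reassoc = solve-∀
  cancel : ∀ a b → a - b + b ≡ a
  cancel = solve-∀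

record IsFibonacci (f : ℤ → ℤ) : Set where
  field
    recurrence : ∀ n → f (n + + 2) ≡ f (n + + 1) + f n

open IsFibonacci

F-isFibonacci : IsFibonacci F
recurrence F-isFibonacci (+ k) rewrite ℕ.+-comm k 2 | ℕ.+-comm k 1 = refl
recurrence F-isFibonacci -[1+ zero ]          = refl
recurrence F-isFibonacci -[1+ suc zero ]      = refl
recurrence F-isFibonacci -[1+ suc (suc j) ]   =
  backwards (negOnePowℕ j) (fibℕ (suc j)) (fibℕ (suc (suc j)))
  where
  backwards : ∀ t f₁ f₂ → t * f₁ ≡ (- t) * f₂ + (- (- t)) * (f₂ + f₁)
  backwards = solve-∀

L-isFibonacci : IsFibonacci L
recurrence L-isFibonacci (+ k) rewrite ℕ.+-comm k 2 | ℕ.+-comm k 1 = refl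
recurrence L-isFibonacci -[1+ zero ]          = refl
recurrence L-isFibonacci -[1+ suc zero ]      = refl
recurrence L-isFibonacci -[1+ suc (suc j) ]   =
  backwards (negOnePowℕ (suc j)) (lucℕ (suc j)) (lucℕ (suc (suc j)))
  where
  backwards : ∀ t l₁ l₂ → t * l₁ ≡ (- t) * l₂ + (- (- t)) * (l₂ + l₁)
  backwards = solve-∀

isFibonacci-unique : ∀ {f g} → IsFibonacci f → IsFibonacci g →
                     f (+ 0) ≡ g (+ 0) → f (+ 1) ≡ g (+ 1) → ∀ n → f n ≡ g n
isFibonacci-unique {f} {g} fib-f fib-g eq₀ eq₁ n =
  proj₁ (ℤ-induction AgreeAt (eq₀ , eq₁) up down n)
  where
  AgreeAt : ℤ → Set
  AgreeAt n = f n ≡ g n × f (n + + 1) ≡ g (n + + 1)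

  two : ∀ n → n + + 1 + + 1 ≡ n + + 2
  two = solve-∀

  next : ∀ h → IsFibonacci h → ∀ n → h (n + + 1 + + 1) ≡ h (n + + 1) + h n
  next h fib-h n = trans (cong h (two n)) (recurrence fib-h n)

  up : ∀ n → AgreeAt n → AgreeAt (n + + 1)
  up n (eq , eq′) = eq′ , (begin
    f (n + + 1 + + 1)    ≡⟨ next f fib-f n ⟩
    f (n + + 1) + f n    ≡⟨ cong₂ _+_ eq′ eq ⟩
    g (n + + 1) + g n    ≡⟨ next g fib-g n ⟨
    g (n + + 1 + + 1)    ∎)

  down : ∀ n → AgreeAt (n + + 1) → AgreeAt n
  down n (eq′ , eq″) = +-cancelˡ (f (n + + 1)) (f n) (g n) (begin
    f (n + + 1) + f n    ≡⟨ next f fib-f n ⟨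
    f (n + + 1 + + 1)    ≡⟨ eq″ ⟩
    g (n + + 1 + + 1)    ≡⟨ next g fib-g n ⟩
    g (n + + 1) + g n    ≡⟨ cong (_+ g n) eq′ ⟨
    f (n + + 1) + g n    ∎) , eq′

isFibonacci-shift : ∀ {f} → IsFibonacci f → ∀ c → IsFibonacci (λ n → f (n + c))
recurrence (isFibonacci-shift {f} fib-f c) n = begin
  f (n + + 2 + c)             ≡⟨ cong f (reindex₂ n c) ⟩
  f (n + c + + 2)             ≡⟨ recurrence fib-f (n + c) ⟩
  f (n + c + + 1) + f (n + c) ≡⟨ cong (λ i → f i + f (n + c)) (reindex₁ n c) ⟩
  f (n + + 1 + c) + f (n + c) ∎
  where
  reindex₂ : ∀ n c → n + + 2 + c ≡ n + c + + 2
  reindex₂ = solve-∀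
  reindex₁ : ∀ n c → n + c + + 1 ≡ n + + 1 + c
  reindex₁ = solve-∀

isFibonacci-+ : ∀ {f g} → IsFibonacci f → IsFibonacci g → IsFibonacci (λ n → f n + g n)
recurrence (isFibonacci-+ {f} {g} fib-f fib-g) n =
  trans (cong₂ _+_ (recurrence fib-f n) (recurrence fib-g n))
        (interchange (f (n + + 1)) (f n) (g (n + + 1)) (g n))
  where
  interchange : ∀ a b c d → (a + b) + (c + d) ≡ (a + c) + (b + d)
  interchange = solve-∀

isFibonacci-*ʳ : ∀ {f} → IsFibonacci f → ∀ c → IsFibonacci (λ n → f n * c)
recurrence (isFibonacci-*ʳ {f} fib-f c) n =
  trans (cong (_* c) (recurrence fib-f n)) (distrib (f (n + + 1)) (f n) c)
  where
  distrib : ∀ a b c → (a + b) * c ≡ a * c + b * c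
  distrib = solve-∀

isFibonacci-reflect : ∀ {f} → IsFibonacci f → ∀ c →
                      IsFibonacci (λ n → negOnePow n * f (c - n))
recurrence (isFibonacci-reflect {f} fib-f c) n = begin
  s (n + + 2) * f (c - (n + + 2))                  ≡⟨ cong₂ _*_ s₂ refl ⟩
  s n * f k                                        ≡⟨ expand (s n) (f (k + + 1)) (f k) ⟩
  (- s n) * f (k + + 1) + s n * (f (k + + 1) + f k)
    ≡⟨ cong₂ (λ t u → t * f (k + + 1) + s n * u) (negOnePow-suc n) (recurrence fib-f k) ⟨
  s (n + + 1) * f (k + + 1) + s n * f (k + + 2)
    ≡⟨ cong₂ (λ i j → s (n + + 1) * f i + s n * f j) (reindex₁ c n) (reindex₂ c n) ⟩
  s (n + + 1) * f (c - (n + + 1)) + s n * f (c - n) ∎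
  where
  s = negOnePow
  k = c - (n + + 2)
  s₂ : s (n + + 2) ≡ s n
  s₂ = begin
    s (n + + 2)        ≡⟨ negOnePow-+ n (+ 2) ⟩
    s n * + 1          ≡⟨ *-identityʳ (s n) ⟩
    s n                ∎
  expand : ∀ t a b → t * b ≡ (- t) * a + t * (a + b)
  expand = solve-∀
  reindex₁ : ∀ c n → c - (n + + 2) + + 1 ≡ c - (n + + 1)
  reindex₁ = solve-∀
  reindex₂ : ∀ c n → c - (n + + 2) + + 2 ≡ c - n
  reindex₂ = solve-∀

L≡F[n-1]+F[n+1] : ∀ n → L n ≡ F (n - + 1) + F (n + + 1)
L≡F[n-1]+F[n+1] = isFibonacci-unique L-isFibonacci
  (isFibonacci-+ (isFibonacci-shift F-isFibonacci (- + 1)) (isFibonacci-shift F-isFibonacci (+ 1)))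
  refl refl

F[a+b]≡F[a]*L[b]±F[b-a] : ∀ a b → F (a + b) ≡ F a * L b + negOnePow a * F (b - a)
F[a+b]≡F[a]*L[b]±F[b-a] a b = isFibonacci-unique
  (isFibonacci-shift F-isFibonacci b)
  (isFibonacci-+ (isFibonacci-*ʳ F-isFibonacci (L b)) (isFibonacci-reflect F-isFibonacci b))
  base₀ base₁ a
  where
  base₀ : F (+ 0 + b) ≡ F (+ 0) * L b + negOnePow (+ 0) * F (b - + 0)
  base₀ = begin
    F (+ 0 + b)                     ≡⟨ cong F (reindex b) ⟩
    F (b - + 0)                     ≡⟨ only-second (L b) (F (b - + 0)) ⟩
    + 0 * L b + + 1 * F (b - + 0)   ∎
    where
    reindex : ∀ b → + 0 + b ≡ b - + 0
    reindex = solve-∀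
    only-second : ∀ x y → y ≡ + 0 * x + + 1 * y
    only-second = solve-∀
  base₁ : F (+ 1 + b) ≡ F (+ 1) * L b + negOnePow (+ 1) * F (b - + 1)
  base₁ = begin
    F (+ 1 + b)                                           ≡⟨ cong F (+-comm (+ 1) b) ⟩
    F (b + + 1)                                           ≡⟨ cancel (F (b - + 1)) (F (b + + 1)) ⟩
    + 1 * (F (b - + 1) + F (b + + 1)) + (- + 1) * F (b - + 1)
      ≡⟨ cong (λ l → + 1 * l + (- + 1) * F (b - + 1)) (L≡F[n-1]+F[n+1] b) ⟨
    + 1 * L b + (- + 1) * F (b - + 1)                     ∎
    where
    cancel : ∀ p q → q ≡ + 1 * (p + q) + (- + 1) * p
    cancel = solve-∀

F[x]*L[x+m]≡±F[x-m]*L[x]+F[m]*L[2x] : ∀ x m →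
  F x * L (x + m) ≡ negOnePow m * F (x - m) * L x + F m * L (x + x)
F[x]*L[x+m]≡±F[x-m]*L[x]+F[m]*L[2x] x m = begin
  u                                   ≡⟨ add-sub u (s x * C) ⟩
  u + s x * C - s x * C               ≡⟨ cong (_- s x * C) e₁ ⟨
  F (x + (x + m)) - s x * C           ≡⟨ cong (λ i → F i - s x * C) (reindex₁ x m) ⟩
  F (m + (x + x)) - s x * C           ≡⟨ cong (_- s x * C) e₃ ⟩
  w + s m * F (x + x - m) - s x * C   ≡⟨ cong (λ i → w + s m * F i - s x * C) (reindex₂ x m) ⟩
  w + s m * F (x - m + x) - s x * C   ≡⟨ cong (λ t → w + s m * t - s x * C) e₂ ⟩
  w + s m * (v + s (x - m) * C) - s x * C
    ≡⟨ rearrange w (s m) (F (x - m)) (L x) (s (x - m)) C (s x) ⟩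
  s m * F (x - m) * L x + w + (s m * s (x - m) - s x) * C
    ≡⟨ cong (λ t → s m * F (x - m) * L x + w + (t - s x) * C) signs ⟩
  s m * F (x - m) * L x + w + (s x - s x) * C
    ≡⟨ drop (s m * F (x - m) * L x + w) (s x) C ⟩
  s m * F (x - m) * L x + w           ∎
  where
  s = negOnePow
  C = F m
  u = F x * L (x + m)
  v = F (x - m) * L x
  w = F m * L (x + x)

  e₁ : F (x + (x + m)) ≡ u + s x * C
  e₁ = trans (F[a+b]≡F[a]*L[b]±F[b-a] x (x + m)) (cong (λ i → u + s x * F i) (m-from x m))
    where
    m-from : ∀ x m → x + m - x ≡ m
    m-from = solve-∀
  e₂ : F (x - m + x) ≡ v + s (x - m) * C
  e₂ = trans (F[a+b]≡F[a]*L[b]±F[b-a] (x - m) x) (cong (λ i → v + s (x - m) * F i) (m-from x m))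
    where
    m-from : ∀ x m → x - (x - m) ≡ m
    m-from = solve-∀
  e₃ : F (m + (x + x)) ≡ w + s m * F (x + x - m)
  e₃ = F[a+b]≡F[a]*L[b]±F[b-a] m (x + x)

  signs : s m * s (x - m) ≡ s x
  signs = trans (sym (negOnePow-+ m (x - m))) (cong s (m+[x-m] x m))
    where
    m+[x-m] : ∀ x m → m + (x - m) ≡ x
    m+[x-m] = solve-∀

  add-sub : ∀ a b → a ≡ a + b - b
  add-sub = solve-∀
  reindex₁ : ∀ x m → x + (x + m) ≡ m + (x + x)
  reindex₁ = solve-∀
  reindex₂ : ∀ x m → x + x - m ≡ x - m + x
  reindex₂ = solve-∀
  rearrange : ∀ w s f l t c r →
              w + s * (f * l + t * c) - r * c ≡ s * f * l + w + (s * t - r) * c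
  rearrange = solve-∀
  drop : ∀ a r c → a + (r - r) * c ≡ a
  drop = solve-∀

sumTo-suc : ∀ a n → sumTo a (n + + 1) ≡ sumTo a n + a (n + + 1)
sumTo-suc a (+ k)          rewrite ℕ.+-comm k 1 = refl
sumTo-suc a -[1+ zero ]    = cancel (a (+ 0))
  where
  cancel : ∀ t → + 0 ≡ - t + t
  cancel = solve-∀
sumTo-suc a -[1+ suc j ]   = cancel (sumNeg a j) (a -[1+ j ])
  where
  cancel : ∀ S t → - S ≡ - (S + t) + t
  cancel = solve-∀

telescope : ∀ (f g d : ℤ → ℤ) → f (+ 0) ≡ g (+ 0) →
            (∀ n → f (n + + 1) ≡ f n + d n) → (∀ n → g (n + + 1) ≡ g n + d n) →
            ∀ n → f n ≡ g n
telescope f g d eq₀ step-f step-g = ℤ-induction (λ n → f n ≡ g n) eq₀ up down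
  where
  up : ∀ n → f n ≡ g n → f (n + + 1) ≡ g (n + + 1)
  up n eq = trans (step-f n) (trans (cong (_+ d n) eq) (sym (step-g n)))
  down : ∀ n → f (n + + 1) ≡ g (n + + 1) → f n ≡ g n
  down n eq = +-cancelʳ (d n) (f n) (g n) (trans (sym (step-f n)) (trans eq (step-g n)))

module _ (m : ℤ) where

  term : ℤ → ℤ
  term k = negOnePow (m * k - + 1) * L (+ 2 * m * k)

  closedForm : ℤ → ℤ
  closedForm n = negOnePow (m * n - + 1) * F (m * n) * L (m * n + m)

  closedForm-zero : closedForm (+ 0) ≡ + 0
  closedForm-zero = cong (λ x → negOnePow (x - + 1) * F x * L (x + m)) (*-zeroʳ m)

  closedForm-suc : ∀ n → closedForm (n + + 1) ≡ closedForm n + F m * term (n + + 1)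
  closedForm-suc n = begin
    σ * F x * L (x + m)
      ≡⟨ *-assoc σ (F x) (L (x + m)) ⟩
    σ * (F x * L (x + m))
      ≡⟨ cong (σ *_) (F[x]*L[x+m]≡±F[x-m]*L[x]+F[m]*L[2x] x m) ⟩
    σ * (negOnePow m * F (x - m) * L x + F m * L (x + x))
      ≡⟨ distribute σ (negOnePow m) (F (x - m)) (L x) (F m) (L (x + x)) ⟩
    σ * negOnePow m * F (x - m) * L x + F m * (σ * L (x + x))
      ≡⟨ cong (_+ F m * (σ * L (x + x)))
              (cong₂ _*_ (cong₂ _*_ signs (cong F (x-m≡mn m n))) (cong L (x≡mn+m m n))) ⟩
    closedForm n + F m * (σ * L (x + x))
      ≡⟨ cong (λ i → closedForm n + F m * (σ * L i)) (x+x≡2mx m n) ⟩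
    closedForm n + F m * term (n + + 1)
      ∎
    where
    x = m * (n + + 1)
    σ = negOnePow (x - + 1)
    signs : σ * negOnePow m ≡ negOnePow (m * n - + 1)
    signs = sym (trans (cong negOnePow (shift m n)) (negOnePow-- (x - + 1) m))
      where
      shift : ∀ m n → m * n - + 1 ≡ m * (n + + 1) - + 1 - m
      shift = solve-∀
    x-m≡mn : ∀ m n → m * (n + + 1) - m ≡ m * n
    x-m≡mn = solve-∀
    x≡mn+m : ∀ m n → m * (n + + 1) ≡ m * n + m
    x≡mn+m = solve-∀
    x+x≡2mx : ∀ m n → m * (n + + 1) + m * (n + + 1) ≡ + 2 * m * (n + + 1)
    x+x≡2mx = solve-∀
    distribute : ∀ σ s f l c k → σ * (s * f * l + c * k) ≡ σ * s * f * l + c * (σ * k)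
    distribute = solve-∀

mainTheorem5 : (m n : ℤ) →
    F m * sumTo (λ k → negOnePow (m * k - + 1) * L (+ 2 * m * k)) n
      ≡ negOnePow (m * n - + 1) * F (m * n) * L (m * n + m)
mainTheorem5 m =
  telescope (λ n → F m * sumTo (term m) n) (closedForm m) (λ n → F m * term m (n + + 1))
  (trans (*-zeroʳ (F m)) (sym (closedForm-zero m)))
  (λ n → trans (cong (F m *_) (sumTo-suc (term m) n)) (*-distribˡ-+ (F m) _ _))
  (closedForm-suc m)
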